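{- Let $\pi=a_1a_2\cdots a_n\in\mathfrak{S}_n$ and let $i_1<i_2<\cdots<i_d$ be the descents of $\pi$ (the indices $i\in[n-1]$ with $a_i>a_{i+1}$). Let $x_k=a_{i_k}$ for $k=1,\dots,d$. Then $$S(\pi)=r_{x_d}r_{x_{d-1}}\cdots r_{x_1}(\pi),$$ where $S$ is the stack-sorting operator.
   Context: The stack-sorting operator $S$ is defined recursively on permutations (words with distinct letters) of finite subsets of $\{1,2,\ldots\}$: if $w$ is empty, $S(w)=w$; otherwise write $w=LmR$ where $m$ is the greatest letter of $w$ and $L,R$ are the subwords to the left and right of $m$, and set $S(w)=S(L)S(R)m$. For a permutation $\sigma=c_1c_2\cdots c_n$ of $[n]$ and a letter $x$ of $\sigma$ that is immediately followed by a smaller letter, with the convention $c_{n+1}=n+1$, let $r_x(\sigma)$ be the permutation obtained by removing $x$ and inserting it between the first pair of consecutive letters $c_j,c_{j+1}$ to the right of $x$ such that $c_j<x<c_{j+1}$. -}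

module Defs where

open import Data.Nat using (ℕ; zero; suc; _<_; _<?_; _⊔_; _≟_)
open import Data.List using (List; []; _∷_; _++_; [_]; length; foldr; foldl; map; upTo)
open import Data.Maybe using (Maybe; just; nothing; _>>=_)
open import Data.Product using (_×_; _,_)
open import Relation.Nullary using (yes; no)
import Data.Maybe as Maybe

-- Words are lists of natural numbers (letters); permutations of [n] are
-- lists that are a rearrangement of 1 2 ... n.

maxLetter : List ℕ → ℕ
maxLetter = foldr _⊔_ 0

splitAt≡ : ℕ → List ℕ → List ℕ × List ℕ
splitAt≡ m [] = [] , []
splitAt≡ m (y ∷ t) with y ≟ m
... | yes _ = [] , t
... | no _ with splitAt≡ m t
...   | (L , R) = (y ∷ L) , R

stackSortFuel : ℕ → List ℕ → List ℕ
stackSortFuel zero w = w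
stackSortFuel (suc k) [] = []
stackSortFuel (suc k) (y ∷ t) with splitAt≡ (maxLetter (y ∷ t)) (y ∷ t)
... | (L , R) = stackSortFuel k L ++ stackSortFuel k R ++ [ maxLetter (y ∷ t) ]

-- The stack-sorting operator S (fuel = length suffices since L, R are shorter).
S : List ℕ → List ℕ
S w = stackSortFuel (length w) w

-- Insert x between the first consecutive pair u v of the word (with final
-- sentinel b appended) such that u < x < v.  Fails if no such pair exists.
insertFirstGap : ℕ → ℕ → List ℕ → Maybe (List ℕ)
insertGapFrom : ℕ → ℕ → ℕ → List ℕ → Maybe (List ℕ)

insertFirstGap x b [] = nothing
insertFirstGap x b (u ∷ t) = insertGapFrom x b u t

insertGapFrom x b u [] with u <? x | x <? b
... | yes _ | yes _ = just (u ∷ x ∷ [])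
... | _     | _     = nothing
insertGapFrom x b u (v ∷ t) with u <? x | x <? v
... | yes _ | yes _ = just (u ∷ x ∷ v ∷ t)
... | _     | _     = Maybe.map (u ∷_) (insertGapFrom x b v t)

-- r_x on a permutation σ of [n] (sentinel c_{n+1} = n+1).  Partial: it is
-- defined (just) only when x is a letter of σ immediately followed by a
-- smaller letter; then x is removed and reinserted in the first gap
-- c_j < x < c_{j+1} to the right of x.
r : ℕ → ℕ → List ℕ → Maybe (List ℕ)
r n x [] = nothing
r n x (y ∷ t) with y ≟ x
r n x (y ∷ []) | yes _ = nothing
r n x (y ∷ c ∷ t) | yes _ with c <? x
... | yes _ = insertFirstGap x (suc n) (c ∷ t)
... | no _  = nothing
r n x (y ∷ t) | no _ = Maybe.map (y ∷_) (r n x t)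

descentTops : List ℕ → List ℕ
descentTopsFrom : ℕ → List ℕ → List ℕ

descentTops [] = []
descentTops (a ∷ t) = descentTopsFrom a t

descentTopsFrom a [] = []
descentTopsFrom a (b ∷ t) with b <? a
... | yes _ = a ∷ descentTopsFrom b t
... | no _  = descentTopsFrom b t

applyRs : ℕ → List ℕ → List ℕ → Maybe (List ℕ)
applyRs n xs σ = foldl (λ acc x → acc >>= r n x) (just σ) xs

oneToN : ℕ → List ℕ
oneToN n = map suc (upTo n)

-- Write a word as w = L m R with m its greatest letter.  Its descent tops are
-- those of L, then m (when R is nonempty), then those of R.  Inductively the
-- moves for the descent tops of L turn L into S(L); then r_m carries m across R,
-- whose letters are all smaller, up to the letter following w, which is larger;
-- finally the moves for R turn R into S(R).  The result is S(L) S(R) m = S(w).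
-- For the induction w is a block inside a longer word P w Q, where the letter
-- after the block (or the sentinel n+1) exceeds every letter of w, and no letter
-- of w occurs in P, since r_x acts at the first occurrence of x.

{-# OPTIONS --safe #-}
module Submission where

open import Defs
open import Function using (_∘_)
open import Data.Nat using (ℕ; zero; suc; _+_; _≤_; _<_; _<?_; _≟_; s≤s⁻¹; s<s)
open import Data.Nat.Properties
  using (≤-refl; ≤-trans; ≤∧≢⇒<; <-asym; m≤m+n; m≤n+m; +-suc; m≤m⊔n; m≤n⊔m; ⊔-sel; ⊔-identityʳ; suc-injective)
open import Data.List using (List; []; _∷_; _++_; [_]; length; foldl)
open import Data.List.Properties using (++-assoc; ++-identityʳ; foldl-++; length-++)
open import Data.Maybe using (just)
import Data.Maybe as Maybe
open import Data.Product using (_×_; _,_; proj₁; proj₂)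
open import Data.Sum using (inj₁; inj₂)
open import Relation.Nullary using (yes; no; contradiction)
open import Relation.Binary.PropositionalEquality
  using (_≡_; refl; sym; trans; cong; cong₂; subst; setoid; module ≡-Reasoning)
open import Data.List.Membership.Propositional using (_∈_; _∉_)
open import Data.List.Membership.Propositional.Properties using (∈-++⁺ˡ; ∈-++⁺ʳ; ∈-++⁻)
open import Data.List.Relation.Unary.Any using (here; there)
open import Data.List.Relation.Unary.All as All using (All; []; _∷_)
import Data.List.Relation.Unary.All.Properties as All
open import Data.List.Relation.Unary.AllPairs using ([]; _∷_)
open import Data.List.Relation.Unary.Unique.Propositional using (Unique)
import Data.List.Relation.Unary.Unique.Propositional.Properties as Unique
open import Data.List.Relation.Binary.Disjoint.Propositional using (Disjoint; contractᵣ)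
open import Data.List.Relation.Binary.Permutation.Propositional
  using (_↭_; ↭-refl; ↭-sym; ↭-trans; ↭-reflexive; ↭⇒↭ₛ)
open import Data.List.Relation.Binary.Permutation.Propositional.Properties
  using (∈-resp-↭; All-resp-↭; ++⁺; ++⁺ˡ; ++⁺ʳ; ++-comm)
import Data.List.Relation.Binary.Permutation.Setoid.Properties as Permutationₛ

Unique-++⁻ : ∀ {A : Set} (xs : List A) {ys} → Unique (xs ++ ys) →
  Unique xs × Unique ys × Disjoint xs ys
Unique-++⁻ []       u = [] , u , λ { (() , _) }
Unique-++⁻ (x ∷ xs) (x∉ ∷ u) with Unique-++⁻ xs u
... | uxs , uys , xs#ys = All.++⁻ˡ xs x∉ ∷ uxs , uys , disjoint
  where
  disjoint : Disjoint (x ∷ xs) _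
  disjoint (here refl , v∈ys) = All.lookup (All.++⁻ʳ xs x∉) v∈ys refl
  disjoint (there v∈xs , v∈ys) = xs#ys (v∈xs , v∈ys)

All≤∧∉⇒All< : ∀ {m xs} → All (_≤ m) xs → m ∉ xs → All (_< m) xs
All≤∧∉⇒All< xs≤m m∉xs = All.tabulate λ x∈xs →
  ≤∧≢⇒< (All.lookup xs≤m x∈xs) λ { refl → m∉xs x∈xs }

maxLetter-∈ : ∀ y t → maxLetter (y ∷ t) ∈ y ∷ t
maxLetter-∈ y [] rewrite ⊔-identityʳ y = here refl
maxLetter-∈ y (z ∷ t) with ⊔-sel y (maxLetter (z ∷ t))
... | inj₁ eq rewrite eq = here refl
... | inj₂ eq rewrite eq = there (maxLetter-∈ z t)

All≤maxLetter : ∀ w → All (_≤ maxLetter w) w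
All≤maxLetter []      = []
All≤maxLetter (y ∷ t) = m≤m⊔n y _ ∷ All.map (λ x≤ → ≤-trans x≤ (m≤n⊔m y _)) (All≤maxLetter t)

splitAt≡-correct : ∀ {m} w → m ∈ w → w ≡ proj₁ (splitAt≡ m w) ++ m ∷ proj₂ (splitAt≡ m w)
splitAt≡-correct {m} (y ∷ t) m∈w with y ≟ m | m∈w
... | yes y≡m | _          = cong (_∷ t) y≡m
... | no y≢m  | here m≡y   = contradiction (sym m≡y) y≢m
... | no _    | there m∈t  = cong (y ∷_) (splitAt≡-correct t m∈t)

length-++-∷-≤ : ∀ {A : Set} (L : List A) {m R k} →
  length (L ++ m ∷ R) ≤ suc k → length L ≤ k × length R ≤ k
length-++-∷-≤ L {m} {R} len = ≤-trans (m≤m+n _ _) sum≤ , ≤-trans (m≤n+m _ _) sum≤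
  where
  sum≤ : length L + length R ≤ _
  sum≤ = s≤s⁻¹ (subst (_≤ _) (trans (length-++ L) (+-suc _ _)) len)

stackSortFuel-[] : ∀ k → stackSortFuel k [] ≡ []
stackSortFuel-[] zero    = refl
stackSortFuel-[] (suc k) = refl

stackSortFuel-↭ : ∀ k w → stackSortFuel k w ↭ w
stackSortFuel-↭ zero    w  = ↭-refl
stackSortFuel-↭ (suc k) [] = ↭-refl
stackSortFuel-↭ (suc k) (y ∷ t)
  with splitAt≡ (maxLetter (y ∷ t)) (y ∷ t) | splitAt≡-correct (y ∷ t) (maxLetter-∈ y t)
... | L , R | w≡ =
  ↭-trans (++⁺ (stackSortFuel-↭ k L) (++⁺ʳ _ (stackSortFuel-↭ k R)))
  (↭-trans (++⁺ˡ L (++-comm R _)) (↭-reflexive (sym w≡)))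

descentTopsFrom-++ : ∀ {m} a L R → a < m → All (_< m) L →
  descentTopsFrom a (L ++ m ∷ R) ≡ descentTopsFrom a L ++ descentTopsFrom m R
descentTopsFrom-++ {m} a [] R a<m [] with m <? a
... | yes m<a = contradiction m<a (<-asym a<m)
... | no _    = refl
descentTopsFrom-++ a (b ∷ L) R _ (b<m ∷ L<m) with b <? a
... | yes _ = cong (a ∷_) (descentTopsFrom-++ b L R b<m L<m)
... | no _  = descentTopsFrom-++ b L R b<m L<m

descentTops-++ : ∀ {m} L R → All (_< m) L →
  descentTops (L ++ m ∷ R) ≡ descentTops L ++ descentTopsFrom m R
descentTops-++ []      R _           = refl
descentTops-++ (a ∷ L) R (a<m ∷ L<m) = descentTopsFrom-++ a L R a<m L<m

descentTopsFrom-descent : ∀ {m c} R → c < m → descentTopsFrom m (c ∷ R) ≡ m ∷ descentTops (c ∷ R)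
descentTopsFrom-descent {m} {c} R c<m with c <? m
... | yes _   = refl
... | no c≮m = contradiction c<m c≮m

applyRs-++ : ∀ n xs ys {σ σ′} → applyRs n xs σ ≡ just σ′ → applyRs n (xs ++ ys) σ ≡ applyRs n ys σ′
applyRs-++ n xs ys {σ} eq =
  trans (foldl-++ (λ acc x → acc Maybe.>>= r n x) (just σ) xs ys)
        (cong (λ acc → foldl _ acc ys) eq)

-- The letter following a block that is followed by Q; at the end of the word
-- it is the sentinel b (= c_{n+1} = n+1 for r).
headOr : ℕ → List ℕ → ℕ
headOr b []      = b
headOr b (c ∷ _) = c

insertGapFrom-after : ∀ {x b u} R Q → u < x → All (_< x) R → x < headOr b Q →
  insertGapFrom x b u (R ++ Q) ≡ just (u ∷ R ++ x ∷ Q)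
insertGapFrom-after {x} {b} {u} [] [] u<x [] x<b with u <? x | x <? b
... | yes _   | yes _   = refl
... | no u≮x | _       = contradiction u<x u≮x
... | yes _   | no x≮b = contradiction x<b x≮b
insertGapFrom-after {x} {u = u} [] (v ∷ Q) u<x [] x<v with u <? x | x <? v
... | yes _   | yes _   = refl
... | no u≮x | _       = contradiction u<x u≮x
... | yes _   | no x≮v = contradiction x<v x≮v
insertGapFrom-after {x} {u = u} (v ∷ R) Q u<x (v<x ∷ R<x) x<b with u <? x | x <? v
... | yes _   | yes x<v = contradiction v<x (<-asym x<v)
... | no u≮x | _       = contradiction u<x u≮x
... | yes _   | no _    = cong (Maybe.map (u ∷_)) (insertGapFrom-after R Q v<x R<x x<b)

r-moveOver : ∀ n {x c} R Q → c < x → All (_< x) R → x < headOr (suc n) Q →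
  r n x (x ∷ c ∷ R ++ Q) ≡ just (c ∷ R ++ x ∷ Q)
r-moveOver n {x} {c} R Q c<x R<x x<b with x ≟ x
... | no x≢x = contradiction refl x≢x
... | yes _ with c <? x
...   | no c≮x = contradiction c<x c≮x
...   | yes _   = insertGapFrom-after R Q c<x R<x x<b

r-++ˡ : ∀ n {x σ σ′} P → x ∉ P → r n x σ ≡ just σ′ → r n x (P ++ σ) ≡ just (P ++ σ′)
r-++ˡ n []      _   eq = eq
r-++ˡ n {x} (y ∷ P) x∉P eq with y ≟ x
... | yes refl = contradiction (here refl) x∉P
... | no _     = cong (Maybe.map (y ∷_)) (r-++ˡ n P (x∉P ∘ there) eq)

SortsInPlace : ℕ → ℕ → Set
SortsInPlace n k = ∀ w P Q → length w ≤ k → Unique w → Disjoint P w → All (_< headOr (suc n) Q) w →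
  applyRs n (descentTops w) (P ++ w ++ Q) ≡ just (P ++ stackSortFuel k w ++ Q)

carryMaxThenSort : ∀ {n k} → SortsInPlace n k → ∀ {m} P R Q →
  length R ≤ k → Unique R → Disjoint P (m ∷ R) → All (_< m) R → m < headOr (suc n) Q →
  applyRs n (descentTopsFrom m R) (P ++ m ∷ R ++ Q) ≡ just (P ++ stackSortFuel k R ++ m ∷ Q)
carryMaxThenSort {k = k} _ P [] Q _ _ _ _ _ rewrite stackSortFuel-[] k = refl
carryMaxThenSort {n} {k} sorts {m} P (c ∷ R) Q len u P#mR (c<m ∷ R<m) m<b = begin
  applyRs n (descentTopsFrom m (c ∷ R)) (P ++ m ∷ c ∷ R ++ Q)
    ≡⟨ cong (λ xs → applyRs n xs (P ++ m ∷ c ∷ R ++ Q)) (descentTopsFrom-descent R c<m) ⟩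
  applyRs n ([ m ] ++ descentTops (c ∷ R)) (P ++ m ∷ c ∷ R ++ Q)
    ≡⟨ applyRs-++ n [ m ] (descentTops (c ∷ R)) {P ++ m ∷ c ∷ R ++ Q}
         (r-++ˡ n P m∉P (r-moveOver n R Q c<m R<m m<b)) ⟩
  applyRs n (descentTops (c ∷ R)) (P ++ (c ∷ R) ++ m ∷ Q)
    ≡⟨ sorts (c ∷ R) P (m ∷ Q) len u (contractᵣ P#mR) (c<m ∷ R<m) ⟩
  just (P ++ stackSortFuel k (c ∷ R) ++ m ∷ Q) ∎
  where
  open ≡-Reasoning
  m∉P : m ∉ P
  m∉P m∈P = P#mR (m∈P , here refl)

sortsInPlace-atMax : ∀ {n k} → SortsInPlace n k → ∀ {L m R} w P Q → w ≡ L ++ m ∷ R → All (_≤ m) w →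
  length w ≤ suc k → Unique w → Disjoint P w → All (_< headOr (suc n) Q) w →
  applyRs n (descentTops w) (P ++ w ++ Q) ≡ just (P ++ (stackSortFuel k L ++ stackSortFuel k R ++ [ m ]) ++ Q)
sortsInPlace-atMax {n} {k} sorts {L} {m} {R} _ P Q refl w≤m len u P#w w<b
  with Unique-++⁻ L u | All.++⁻ L w≤m | length-++-∷-≤ L len
... | uL , u[mR]@(_ ∷ uR) , L#mR | L≤m , _ ∷ R≤m | lenL , lenR = begin
  applyRs n (descentTops (L ++ m ∷ R)) (P ++ (L ++ m ∷ R) ++ Q)
    ≡⟨ cong₂ (applyRs n) (descentTops-++ L R L<m) (cong (P ++_) (++-assoc L _ Q)) ⟩
  applyRs n (descentTops L ++ descentTopsFrom m R) (P ++ L ++ m ∷ R ++ Q)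
    ≡⟨ applyRs-++ n (descentTops L) _ (sorts L P (m ∷ R ++ Q) lenL uL P#L L<m) ⟩
  applyRs n (descentTopsFrom m R) (P ++ SL ++ m ∷ R ++ Q)
    ≡⟨ cong (applyRs n (descentTopsFrom m R)) (sym (++-assoc P SL _)) ⟩
  applyRs n (descentTopsFrom m R) ((P ++ SL) ++ m ∷ R ++ Q)
    ≡⟨ carryMaxThenSort sorts (P ++ SL) R Q lenR uR P++SL#mR R<m m<b ⟩
  just ((P ++ SL) ++ SR ++ m ∷ Q)
    ≡⟨ cong just (++-assoc P SL _) ⟩
  just (P ++ SL ++ SR ++ m ∷ Q)
    ≡⟨ cong (λ xs → just (P ++ xs)) (sym sorted++Q) ⟩
  just (P ++ (SL ++ SR ++ [ m ]) ++ Q) ∎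
  where
  open ≡-Reasoning
  SL SR : List ℕ
  SL = stackSortFuel k L
  SR = stackSortFuel k R
  sorted++Q : (SL ++ SR ++ [ m ]) ++ Q ≡ SL ++ SR ++ m ∷ Q
  sorted++Q = trans (++-assoc SL _ Q) (cong (SL ++_) (++-assoc SR [ m ] Q))
  L<m : All (_< m) L
  L<m = All≤∧∉⇒All< L≤m (λ m∈L → L#mR (m∈L , here refl))
  R<m : All (_< m) R
  R<m = All≤∧∉⇒All< R≤m (Unique.Unique[x∷xs]⇒x∉xs u[mR])
  m<b : m < headOr (suc n) Q
  m<b = All.lookup w<b (∈-++⁺ʳ L (here refl))
  P#L : Disjoint P L
  P#L (v∈P , v∈L) = P#w (v∈P , ∈-++⁺ˡ v∈L)
  P++SL#mR : Disjoint (P ++ SL) (m ∷ R)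
  P++SL#mR (v∈P++SL , v∈mR) with ∈-++⁻ P v∈P++SL
  ... | inj₁ v∈P  = P#w (v∈P , ∈-++⁺ʳ L v∈mR)
  ... | inj₂ v∈SL = L#mR (∈-resp-↭ (stackSortFuel-↭ k L) v∈SL , v∈mR)

sortsInPlace : ∀ n k → SortsInPlace n k
sortsInPlace n zero    []      P Q _ _ _ _ = refl
sortsInPlace n zero    (y ∷ t) P Q ()
sortsInPlace n (suc k) []      P Q _ _ _ _ = refl
sortsInPlace n (suc k) (y ∷ t) P Q
  with splitAt≡ (maxLetter (y ∷ t)) (y ∷ t) | splitAt≡-correct (y ∷ t) (maxLetter-∈ y t)
... | L , R | w≡ = sortsInPlace-atMax (sortsInPlace n k) (y ∷ t) P Q w≡ (All≤maxLetter (y ∷ t))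

Unique-oneToN : ∀ n → Unique (oneToN n)
Unique-oneToN n = Unique.map⁺ suc-injective (Unique.upTo⁺ n)

All<-oneToN : ∀ n → All (_< suc n) (oneToN n)
All<-oneToN n = All.map⁺ (All.map s<s (All.all-upTo n))

theorem4p1 : (n : ℕ) (π : List ℕ) → π ↭ oneToN n →
    applyRs n (descentTops π) π ≡ just (S π)
theorem4p1 n π π↭ = begin
  applyRs n (descentTops π) π
    ≡⟨ cong (applyRs n (descentTops π)) (sym (++-identityʳ π)) ⟩
  applyRs n (descentTops π) ([] ++ π ++ [])
    ≡⟨ sortsInPlace n (length π) π [] [] ≤-refl distinct (λ { (() , _) }) bounded ⟩
  just (S π ++ [])
    ≡⟨ cong just (++-identityʳ (S π)) ⟩
  just (S π) ∎
  where
  open ≡-Reasoning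
  distinct : Unique π
  distinct = Permutationₛ.Unique-resp-↭ (setoid ℕ) (↭⇒↭ₛ (↭-sym π↭)) (Unique-oneToN n)
  bounded : All (_< suc n) π
  bounded = All-resp-↭ (↭-sym π↭) (All<-oneToN n)
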